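{- Let $\Omega$ be the set of irrational points of $[0,1)$, $\mathcal{M}$ a finite set, $f_a:\mathcal{M}\to\mathcal{M}$ ($a\in\mathbb{N}$) functions, and $\widetilde{T}(x,M)=(Tx,f_{a_1(x)}(M))$ on $\Omega\times\mathcal{M}$. If $\widetilde{T}$ is transitive, then a traversing string exists.
   Context: $T$ is the Gauss map $Tx=1/x-\lfloor1/x\rfloor$ and $a_1(x)=\lfloor 1/x\rfloor$ the first continued fraction digit. For a string $s=[c_1,\dots,c_k]$ of positive integers, $C_s=\{x\in\Omega:a_i(x)=c_i,1\le i\le k\}$. $\widetilde{T}$ is transitive if for all $M_1,M_2\in\mathcal{M}$ there is a string $s$ of length $n$ with $\widetilde{T}^n(C_s\times\{M_1\})=\Omega\times\{M_2\}$. A string $s=[c_1,\dots,c_n]$ is traversing if for every $M_1,M_2\in\mathcal{M}$ there exists $i<n$ with $\widetilde{T}^i(C_s\times\{M_1\})\subset\Omega\times\{M_2\}$. -}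

module Defs where

open import Data.Nat using (ℕ; zero; suc; _≤_; _<_)
open import Data.Fin using (Fin)
open import Data.List using (List; []; _∷_; length)
open import Data.List.Relation.Unary.All using (All)
open import Data.Product using (Σ; ∃; _×_; _,_; proj₁; proj₂)
open import Data.Unit using (⊤)
open import Relation.Binary.PropositionalEquality using (_≡_)

-- Points of Ω (irrationals in [0,1)) are represented by their continued
-- fraction digit sequences: x = [a₁(x), a₂(x), ...] ↦ (λ i → a_{i+1}(x)).
-- This is the standard bijection between Ω and sequences of positive integers.
Seq : Set
Seq = ℕ → ℕ

InΩ : Seq → Set
InΩ x = ∀ i → 1 ≤ x i

_≈_ : Seq → Seq → Set
x ≈ y = ∀ i → x i ≡ y i

-- Gauss map T (shift on digits) and first digit a₁
T : Seq → Seq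
T x i = x (suc i)

a₁ : Seq → ℕ
a₁ x = x 0

module Skew (m : ℕ) (f : ℕ → Fin m → Fin m) where

  Pt : Set
  Pt = Seq × Fin m

  T̃ : Pt → Pt
  T̃ (x , M) = (T x , f (a₁ x) M)

  T̃^ : ℕ → Pt → Pt
  T̃^ zero p = p
  T̃^ (suc n) p = T̃^ n (T̃ p)

  String : Set
  String = List ℕ

  ValidString : String → Set
  ValidString s = All (λ c → 1 ≤ c) s

  HasPrefix : String → Seq → Set
  HasPrefix [] x = ⊤
  HasPrefix (c ∷ s) x = (a₁ x ≡ c) × HasPrefix s (T x)

  C : String → Seq → Set
  C s x = InΩ x × HasPrefix s x

  InCyl× : String → Fin m → Pt → Set
  InCyl× s M₁ (x , M) = C s x × (M ≡ M₁)

  InΩ× : Fin m → Pt → Set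
  InΩ× M₂ (x , M) = InΩ x × (M ≡ M₂)

  InImage : ℕ → (Pt → Set) → Pt → Set
  InImage n A (x , M) = ∃ λ p → A p × (proj₁ (T̃^ n p) ≈ x) × (proj₂ (T̃^ n p) ≡ M)

  ImageIsFull : String → Fin m → Fin m → Set
  ImageIsFull s M₁ M₂ =
    ∀ q → (InImage (length s) (InCyl× s M₁) q → InΩ× M₂ q)
        × (InΩ× M₂ q → InImage (length s) (InCyl× s M₁) q)

  Transitive : Set
  Transitive = ∀ (M₁ M₂ : Fin m) → ∃ λ s → ValidString s × ImageIsFull s M₁ M₂

  ImageSub : ℕ → String → Fin m → Fin m → Set
  ImageSub i s M₁ M₂ = ∀ p → InCyl× s M₁ p → InΩ× M₂ (T̃^ i p)

  Traversing : String → Set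
  Traversing s = ValidString s ×
    (∀ (M₁ M₂ : Fin m) → ∃ λ i → (i < length s) × ImageSub i s M₁ M₂)

{-# OPTIONS --safe #-}
-- For each pair (M₁, M₂) transitivity yields a digit string that drives the fibre from M₁
-- to M₂. Running through all pairs, and each time appending the string that drives the
-- current image of M₁ to M₂, produces one string in which, for every pair, some prefix
-- drives M₁ to M₂. Along a cylinder the fibre coordinate after i steps only depends on
-- the first i digits, so the length of that prefix is the required index i.
module Submission where

open import Defs
open import Data.Nat using (ℕ; zero; suc; _<_; s≤s; z≤n)
open import Data.Nat.Properties using (≤-<-trans; m<m+n)
open import Data.Fin using (Fin)
open import Data.Product using (∃; ∃₂; _×_; _,_; proj₁; proj₂)
open import Data.List using (List; []; _∷_; _++_; _∷ʳ_; [_]; length; foldl; allFin; cartesianProduct)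
open import Data.List.Properties using (foldl-++; ++-assoc; length-++; length-++-≤ˡ)
open import Data.List.Relation.Unary.All using (All; []; _∷_)
open import Data.List.Relation.Unary.All.Properties using (++⁺)
open import Data.List.Relation.Unary.Any using (here; there)
open import Data.List.Membership.Propositional using (_∈_)
open import Data.List.Membership.Propositional.Properties using (∈-cartesianProduct⁺; ∈-allFin)
open import Data.Unit using (tt)
open import Function using (_∘_; id; flip)
open import Relation.Binary.PropositionalEquality using (_≡_; refl; sym; trans; cong; subst)

module Steering {A S : Set} (δ : A → S → S) where

  act : List A → S → S
  act s M = foldl (flip δ) M s

  act-++ : ∀ u v M → act (u ++ v) M ≡ act v (act u M)
  act-++ u v M = foldl-++ (flip δ) M u v

  module _ {P : A → Set} (steer : ∀ a b → ∃ λ s → All P s × act s a ≡ b) where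

    route : S → S → List A
    route a b = proj₁ (steer a b)

    -- g is the action of the part of the word already written.
    walk : (S → S) → List (S × S) → List A
    walk g [] = []
    walk g ((a , b) ∷ ps) = route (g a) b ++ walk (act (route (g a) b) ∘ g) ps

    walk-valid : ∀ g ps → All P (walk g ps)
    walk-valid g [] = []
    walk-valid g ((a , b) ∷ ps) =
      ++⁺ (proj₁ (proj₂ (steer (g a) b))) (walk-valid (act (route (g a) b) ∘ g) ps)

    walk-steers : ∀ g ps {a b} → (a , b) ∈ ps →
                  ∃₂ λ u v → walk g ps ≡ u ++ v × act u (g a) ≡ b
    walk-steers g ((a , b) ∷ ps) (here refl) =
      route (g a) b , _ , refl , proj₂ (proj₂ (steer (g a) b))
    walk-steers g ((a′ , b′) ∷ ps) {a} {b} (there a,b∈ps)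
      with r ← route (g a′) b′
         | u , v , eq , u-steers ← walk-steers (act (route (g a′) b′) ∘ g) ps a,b∈ps =
      r ++ u , v , trans (cong (r ++_) eq) (sym (++-assoc r u v)) ,
      trans (act-++ r u (g a)) u-steers

module Traversal (m : ℕ) (f : ℕ → Fin m → Fin m) where
  open Skew m f
  open Steering f

  T̃^-preserves-Ω : ∀ i {x} M → InΩ x → InΩ (proj₁ (T̃^ i (x , M)))
  T̃^-preserves-Ω zero    M x∈Ω = x∈Ω
  T̃^-preserves-Ω (suc i) M x∈Ω = T̃^-preserves-Ω i _ (x∈Ω ∘ suc)

  T̃^-fibre : ∀ u {x} M → HasPrefix u x → proj₂ (T̃^ (length u) (x , M)) ≡ act u M
  T̃^-fibre []      M tt             = refl
  T̃^-fibre (c ∷ u) M (refl , x∈Cu) = T̃^-fibre u _ x∈Cu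

  HasPrefix-++⁻ˡ : ∀ u {v x} → HasPrefix (u ++ v) x → HasPrefix u x
  HasPrefix-++⁻ˡ []      _              = tt
  HasPrefix-++⁻ˡ (c ∷ u) (a₁≡c , x∈Cuv) = a₁≡c , HasPrefix-++⁻ˡ u x∈Cuv

  -- Only the inclusion Ω × {M₂} ⊆ T̃ⁿ(C_s × {M₁}) is used, at the point (1,1,1,…).
  full⇒act≡ : ∀ s {M₁ M₂} → ImageIsFull s M₁ M₂ → act s M₁ ≡ M₂
  full⇒act≡ s {M₁} {M₂} full
    with (x , _) , ((_ , x∈Cs) , refl) , _ , fibre≡M₂
           ← proj₂ (full ((λ _ → 1) , M₂)) ((λ _ → s≤s z≤n) , refl) =
    trans (sym (T̃^-fibre s M₁ x∈Cs)) fibre≡M₂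

  prefix-ImageSub : ∀ u v {M₁ M₂} → act u M₁ ≡ M₂ → ImageSub (length u) (u ++ v) M₁ M₂
  prefix-ImageSub u v u-steers (x , M) ((x∈Ω , x∈Cuv) , refl) =
    T̃^-preserves-Ω (length u) M x∈Ω ,
    trans (T̃^-fibre u M (HasPrefix-++⁻ˡ u x∈Cuv)) u-steers

  -- The final digit makes every prefix proper, as the definition demands i < n.
  traversing-∷ʳ : ∀ s → ValidString s →
                  (∀ M₁ M₂ → ∃₂ λ u v → s ≡ u ++ v × act u M₁ ≡ M₂) →
                  Traversing (s ∷ʳ 1)
  traversing-∷ʳ s s-valid prefixes = ++⁺ s-valid (s≤s z≤n ∷ []) , traverses
    where
    s<s∷ʳ1 : length s < length (s ∷ʳ 1)
    s<s∷ʳ1 = subst (length s <_) (sym (length-++ s)) (m<m+n (length s) (s≤s z≤n))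

    traverses : ∀ M₁ M₂ → ∃ λ i → i < length (s ∷ʳ 1) × ImageSub i (s ∷ʳ 1) M₁ M₂
    traverses M₁ M₂ with u , v , refl , u-steers ← prefixes M₁ M₂ =
      length u ,
      ≤-<-trans (length-++-≤ˡ u) s<s∷ʳ1 ,
      subst (λ t → ImageSub (length u) t M₁ M₂) (sym (++-assoc u v [ 1 ]))
            (prefix-ImageSub u (v ∷ʳ 1) u-steers)

lemma3p3 : (m : ℕ) (f : ℕ → Fin m → Fin m) →
    Skew.Transitive m f → ∃ λ s → Skew.Traversing m f s
lemma3p3 m f transitive = s ∷ʳ 1 , traversing-∷ʳ s (walk-valid steer id pairs) prefixes
  where
  open Skew m f
  open Steering f
  open Traversal m f

  steer : ∀ M₁ M₂ → ∃ λ s → ValidString s × act s M₁ ≡ M₂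
  steer M₁ M₂ with s , s-valid , full ← transitive M₁ M₂ = s , s-valid , full⇒act≡ s full

  pairs : List (Fin m × Fin m)
  pairs = cartesianProduct (allFin m) (allFin m)

  s : String
  s = walk steer id pairs

  prefixes : ∀ M₁ M₂ → ∃₂ λ u v → s ≡ u ++ v × act u M₁ ≡ M₂
  prefixes M₁ M₂ = walk-steers steer id pairs (∈-cartesianProduct⁺ (∈-allFin M₁) (∈-allFin M₂))
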